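{- For every integer $n\ge7$, the fan $F_n$ is not a willow.
   Context: For $n\ge3$, $F_n$ is the $(n+1)$-vertex graph with a vertex $c$ (the center) adjacent to all other vertices such that $F_n\setminus c$ is the path $P_n$ on $n$ vertices. For a positive integer $m$, a graph $G$ is an $m$-willow if there exists an oriented tree $T$ with $V(G)\subseteq V(T)$ such that for all distinct $u,v\in V(G)$, $u$ and $v$ are adjacent in $G$ if and only if $T$ has a directed path from $u$ to $v$ or from $v$ to $u$ whose length is not a multiple of $m$. A willow is a graph that is an $m$-willow for some positive integer $m$. -}

module Defs where

open import Data.Nat using (ℕ; zero; suc; _≤_)
open import Data.Nat.Divisibility using (_∣_)
open import Data.Fin using (Fin; zero; suc; toℕ; fromℕ; inject₁)
open import Data.Bool using (Bool; true; false; _∨_)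
open import Data.Product using (Σ; _×_; _,_)
open import Data.Sum using (_⊎_)
open import Relation.Binary.PropositionalEquality using (_≡_; _≢_)
open import Relation.Nullary using (¬_)
open import Function.Definitions using (Injective)
open import Function.Bundles using (_⇔_)

Digraph : ℕ → Set
Digraph k = Fin k → Fin k → Bool

record Path {k : ℕ} (R : Digraph k) (u v : Fin k) (len : ℕ) : Set where
  field
    verts    : Fin (suc len) → Fin k
    start    : verts zero ≡ u
    end      : verts (fromℕ len) ≡ v
    steps    : ∀ (i : Fin len) → R (verts (inject₁ i)) (verts (suc i)) ≡ true
    distinct : Injective _≡_ _≡_ verts

Und : ∀ {k} → Digraph k → Digraph k
Und A u v = A u v ∨ A v u

Connected : ∀ {k} → Digraph k → Set
Connected {k} A = ∀ (u v : Fin k) → Σ ℕ λ len → Path (Und A) u v len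

HasCycle : ∀ {k} → Digraph k → Set
HasCycle {k} A = Σ ℕ λ l → Σ (Fin k) λ u → Σ (Fin k) λ v →
  (2 ≤ l) × Path (Und A) u v l × (Und A v u ≡ true)

Oriented : ∀ {k} → Digraph k → Set
Oriented {k} A = (∀ (u : Fin k) → A u u ≡ false) × (∀ (u v : Fin k) → A u v ≡ true → A v u ≡ false)

OrientedTree : ∀ {k} → Digraph k → Set
OrientedTree A = Oriented A × Connected A × ¬ HasCycle A

GoodDirPath : ∀ {k} → ℕ → Digraph k → Fin k → Fin k → Set
GoodDirPath m T u v = Σ ℕ λ len → Path T u v len × ¬ (m ∣ len)

-- G (vertex set Fin N, adjacency Adj) is an m-willow.
-- V(G) ⊆ V(T) is encoded by an injection f : Fin N → Fin k.
IsMWillow : ℕ → (N : ℕ) → (Fin N → Fin N → Set) → Set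
IsMWillow m N Adj =
  Σ ℕ λ k → Σ (Digraph k) λ T → OrientedTree T ×
  Σ (Fin N → Fin k) λ f → Injective _≡_ _≡_ f ×
  (∀ (u v : Fin N) → u ≢ v →
     Adj u v ⇔ (GoodDirPath m T (f u) (f v) ⊎ GoodDirPath m T (f v) (f u)))

IsWillow : (N : ℕ) → (Fin N → Fin N → Set) → Set
IsWillow N Adj = Σ ℕ λ m → (1 ≤ m) × IsMWillow m N Adj

-- The fan F_n on vertex set Fin (suc n): vertex 0 is the center c,
-- vertices 1,…,n form the path P_n in order.
FanAdj : (n : ℕ) → Fin (suc n) → Fin (suc n) → Set
FanAdj n u v =
    (u ≡ zero × v ≢ zero)
  ⊎ (v ≡ zero × u ≢ zero)
  ⊎ (u ≢ zero × suc (toℕ u) ≡ toℕ v)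
  ⊎ (v ≢ zero × suc (toℕ v) ≡ toℕ u)

-- Directed paths in an oriented tree compose, have unique lengths, and if a → y → b and a → z → b
-- then y and z lie on one directed path.  Let c be the centre of F_n and v₀, …, v₆ its first seven
-- path vertices.  Each vᵢ is joined to c by a directed path; its length hᵢ, taken negative when the
-- path ends at c, satisfies hⱼ = hᵢ + L for every directed path vᵢ → vⱼ of length L.  So hᵢ ≡ hⱼ
-- (mod m) whenever vᵢ, vⱼ are non-adjacent and joined by a directed path, and never for consecutive
-- vᵢ, vⱼ.  Two far apart vertices on opposite sides of c are joined through c; on seven positions
-- this forces all vᵢ to one side.  Reversing T if necessary, c reaches every vᵢ, and then so does the
-- vᵢ closest to c (by comparability of paths out of c), giving congruent heights to a consecutive
-- pair far from it.

module Submission where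

open import Defs
open import Data.Nat as ℕ using (ℕ; zero; suc; _+_; _≤_; _≤ᵇ_; z≤n; s≤s)
open import Data.Nat.Properties using (+-comm; suc-injective; 1+n≢n; m+1+n≰m; m+n≡0⇒m≡0; m+n≡0⇒n≡0)
open import Data.Nat.Divisibility using (_∣_; _∣?_)
open import Data.Integer as ℤ using (ℤ; +_; -_)
open import Data.Integer.Properties using (pos-+; ∣-i∣≡∣i∣)
open import Data.Integer.Divisibility.Signed using (∣m⇒∣-m; ∣m∣n⇒∣m+n; ∣⇒∣ᵤ; ∣ᵤ⇒∣) renaming (_∣_ to _∣ℤ_)
open import Data.Integer.Tactic.RingSolver using (solve-∀)
open import Data.Fin using (Fin; zero; suc; toℕ; fromℕ; inject₁; inject≤)
open import Data.Fin.Properties using (toℕ-inject≤; toℕ-inject₁) renaming (_≟_ to _≟ᶠ_)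
open import Data.Fin.Patterns using (0F; 1F; 2F; 3F; 4F; 5F; 6F)
open import Data.Fin.Induction using (<-weakInduction)
open import Data.Bool as Bool using (Bool; true; false; T; _∨_)
open import Data.Bool.Properties using (∨-comm)
open import Data.List using (List; []; _∷_; _++_; length; lookup; tabulate; allFin)
open import Data.List.Properties using (length-++; length-tabulate)
open import Data.List.Extrema.Nat using (argmin; f[argmin]≤f[xs])
open import Data.List.Membership.Propositional using (_∈_)
open import Data.List.Membership.Propositional.Properties using (∈-lookup; ∈-++⁺ˡ; ∈-++⁻; ∈-allFin)
open import Data.List.Relation.Unary.Any using (here; there; any?)
open import Data.List.Relation.Unary.All as All using (All; []; _∷_)
open import Data.List.Relation.Unary.All.Properties using (¬Any⇒All¬; All¬⇒¬Any)
open import Data.List.Relation.Unary.AllPairs using ([]; _∷_)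
open import Data.List.Relation.Unary.Unique.Propositional using (Unique)
open import Data.Product as Product using (∃; _×_; _,_; proj₁; proj₂)
open import Data.Sum as Sum using (_⊎_; inj₁; inj₂)
open import Data.Empty using (⊥; ⊥-elim)
open import Function.Bundles using (_⇔_; mk⇔; Equivalence)
open import Function.Definitions using (Injective)
open import Relation.Binary.Core using (Rel)
open import Relation.Binary.Definitions using (DecidableEquality; Symmetric; Transitive)
open import Relation.Binary.PropositionalEquality using (_≡_; _≢_; refl; sym; trans; cong; subst; subst₂)
open import Relation.Nullary using (¬_; yes; no)
open import Relation.Unary using (Pred)
open import Level using (0ℓ)

-- Walks and paths

data Chain {V : Set} (R : Rel V 0ℓ) : V → V → List V → Set where
  [] : ∀ {x} → Chain R x x []
  _∷_ : ∀ {x y z ys} → R x y → Chain R y z ys → Chain R x z (y ∷ ys)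

module _ {V : Set} {R : Rel V 0ℓ} where

  infixr 5 _++ᶜ_
  _++ᶜ_ : ∀ {x y z xs ys} → Chain R x y xs → Chain R y z ys → Chain R x z (xs ++ ys)
  [] ++ᶜ d = d
  (r ∷ c) ++ᶜ d = r ∷ (c ++ᶜ d)

  mapᶜ : ∀ {S : Rel V 0ℓ} → (∀ {x y} → R x y → S x y) → ∀ {x y xs} → Chain R x y xs → Chain S x y xs
  mapᶜ f [] = []
  mapᶜ f (r ∷ c) = f r ∷ mapᶜ f c

  reverseᶜ : Symmetric R → ∀ {x y xs} → Chain R x y xs → ∃ (Chain R y x)
  reverseᶜ R-sym [] = [] , []
  reverseᶜ R-sym (r ∷ c) with reverseᶜ R-sym c
  ... | _ , c⁻¹ = _ , c⁻¹ ++ᶜ (R-sym r ∷ [])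

  end∈ : ∀ {x y xs} → Chain R x y xs → y ∈ x ∷ xs
  end∈ [] = here refl
  end∈ (r ∷ c) = there (end∈ c)

  prefix : ∀ {x y w xs} → Chain R x y xs → w ∈ x ∷ xs → ∃ (Chain R x w)
  prefix c (here refl) = [] , []
  prefix (r ∷ c) (there w∈) with prefix c w∈
  ... | _ , c′ = _ , r ∷ c′

  suffix : ∀ {x y w xs} → Chain R x y xs → Unique (x ∷ xs) → w ∈ x ∷ xs →
           ∃ λ ys → Chain R w y ys × Unique (w ∷ ys)
  suffix c u (here refl) = _ , c , u
  suffix (r ∷ c) (_ ∷ u) (there w∈) = suffix c u w∈

  erase-loops : DecidableEquality V → ∀ {x y xs} → Chain R x y xs →
                ∃ λ ys → Chain R x y ys × Unique (x ∷ ys)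
  erase-loops _≟_ [] = [] , [] , [] ∷ []
  erase-loops _≟_ {x} (r ∷ c) with erase-loops _≟_ c
  ... | ys , c′ , u with any? (x ≟_) (_ ∷ ys)
  ...   | yes x∈ = suffix c′ u x∈
  ...   | no x∉ = _ , r ∷ c′ , ¬Any⇒All¬ _ x∉ ∷ u

Within : {V : Set} → Pred V 0ℓ → Rel V 0ℓ → Rel V 0ℓ
Within P R x y = P x × R x y × P y

module _ {V : Set} {P : Pred V 0ℓ} {R : Rel V 0ℓ} where

  within : ∀ {x y xs} → All P (x ∷ xs) → Chain R x y xs → Chain (Within P R) x y xs
  within _ [] = []
  within (px ∷ pys@(py ∷ _)) (r ∷ c) = (px , r , py) ∷ within pys c

  within-sym : Symmetric R → Symmetric (Within P R)
  within-sym R-sym (px , r , py) = py , R-sym r , px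

  within-All : ∀ {x y xs} → Chain (Within P R) x y xs → All P xs
  within-All [] = []
  within-All ((_ , _ , py) ∷ c) = py ∷ within-All c

lookup-injective : ∀ {A : Set} {xs : List A} → Unique xs → Injective _≡_ _≡_ (lookup xs)
lookup-injective {xs = _ ∷ _} _ {zero} {zero} _ = refl
lookup-injective {xs = _ ∷ _} (x∉ ∷ _) {zero} {suc j} eq =
  ⊥-elim (All¬⇒¬Any x∉ (subst (_∈ _) (sym eq) (∈-lookup j)))
lookup-injective {xs = _ ∷ _} (x∉ ∷ _) {suc i} {zero} eq =
  ⊥-elim (All¬⇒¬Any x∉ (subst (_∈ _) eq (∈-lookup i)))
lookup-injective {xs = _ ∷ _} (_ ∷ u) {suc i} {suc j} eq = cong suc (lookup-injective u eq)

module _ {k : ℕ} (G : Digraph k) where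

  Arc : Rel (Fin k) 0ℓ
  Arc x y = G x y ≡ true

  chain⇒path : ∀ {u v xs} → Chain Arc u v xs → Unique (u ∷ xs) → Path G u v (length xs)
  chain⇒path {u} {xs = xs} c uq = record
    { verts = lookup (u ∷ xs) ; start = refl ; end = lookup-last c ; steps = lookup-steps c
    ; distinct = lookup-injective uq }
    where
    lookup-last : ∀ {u v xs} → Chain Arc u v xs → lookup (u ∷ xs) (fromℕ (length xs)) ≡ v
    lookup-last [] = refl
    lookup-last (_ ∷ c) = lookup-last c
    lookup-steps : ∀ {u v xs} → Chain Arc u v xs →
                   ∀ i → Arc (lookup (u ∷ xs) (inject₁ i)) (lookup (u ∷ xs) (suc i))
    lookup-steps (r ∷ _) zero = r
    lookup-steps (_ ∷ c) (suc i) = lookup-steps c i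

  path⇒chain : ∀ {u v len} → Path G u v len → ∃ λ xs → Chain Arc u v xs × length xs ≡ len
  path⇒chain p =
    tabulate (λ i → verts (suc i)) ,
    subst₂ (λ a b → Chain Arc a b _) start end (tabulate-chain verts steps) , length-tabulate _
    where
    open Path p
    tabulate-chain : ∀ {n} (f : Fin (suc n) → Fin k) → (∀ i → Arc (f (inject₁ i)) (f (suc i))) →
                     Chain Arc (f zero) (f (fromℕ n)) (tabulate (λ i → f (suc i)))
    tabulate-chain {zero} f arcs = []
    tabulate-chain {suc n} f arcs = arcs zero ∷ tabulate-chain (λ i → f (suc i)) (λ i → arcs (suc i))

-- Directed paths in oriented forests

-- The properties of directed paths in an oriented forest used below; stating them abstractly makes
-- reversing every arc (opposite) free.
record DirectedPaths (V : Set) : Set₁ where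
  infix 4 _⟶[_]_
  field
    _⟶[_]_ : V → ℕ → V → Set
    ⟶-refl : ∀ {x} → x ⟶[ 0 ] x
    ⟶-trans : ∀ {x y z p q} → x ⟶[ p ] y → y ⟶[ q ] z → x ⟶[ p + q ] z
    ⟶-unique : ∀ {x y p q} → x ⟶[ p ] y → x ⟶[ q ] y → p ≡ q
    ⟶-zero : ∀ {x y} → x ⟶[ 0 ] y → x ≡ y
    ⟶-comparable : ∀ {a b y z p q r s} → a ⟶[ p ] y → y ⟶[ q ] b → a ⟶[ r ] z → z ⟶[ s ] b →
                   (∃ λ L → y ⟶[ L ] z) ⊎ (∃ λ L → z ⟶[ L ] y)

  infix 4 _⟷[_]_
  _⟷[_]_ : V → ℕ → V → Set
  x ⟷[ L ] y = x ⟶[ L ] y ⊎ y ⟶[ L ] x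

opposite : ∀ {V} → DirectedPaths V → DirectedPaths V
opposite P = record
  { _⟶[_]_ = λ x L y → y ⟶[ L ] x
  ; ⟶-refl = ⟶-refl
  ; ⟶-trans = λ {x} {z = z} {p} {q} yx zy → subst (z ⟶[_] x) (+-comm q p) (⟶-trans zy yx)
  ; ⟶-unique = ⟶-unique
  ; ⟶-zero = λ yx → sym (⟶-zero yx)
  ; ⟶-comparable = λ ya by za bz → Sum.swap (⟶-comparable by ya bz za)
  }
  where open DirectedPaths P

module OrientedForest {k : ℕ} (T : Digraph k) (oriented : Oriented T) (acyclic : ¬ HasCycle T) where

  Edge : Rel (Fin k) 0ℓ
  Edge = Arc (Und T)

  edge-sym : Symmetric Edge
  edge-sym {x} {y} e = trans (∨-comm (T y x) (T x y)) e

  arc⇒edge : ∀ {x y} → Arc T x y → Edge x y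
  arc⇒edge xy rewrite xy = refl

  no-cycle : ∀ {u v xs} → Chain Edge u v xs → Unique (u ∷ xs) → 2 ≤ length xs → Edge v u → ⊥
  no-cycle c u 2≤len vu = acyclic (_ , _ , _ , 2≤len , chain⇒path (Und T) c u , vu)

  no-bypass : ∀ {a p q xs} → Edge a p → Edge a q → p ≢ q → a ≢ p → Chain (Within (a ≢_) Edge) p q xs → ⊥
  no-bypass ap aq p≢q a≢p c with erase-loops _≟ᶠ_ c
  ... | [] , [] , _ = p≢q refl
  ... | _ ∷ _ , c′ , u = no-cycle (ap ∷ mapᶜ (λ w → proj₁ (proj₂ w)) c′) ((a≢p ∷ within-All c′) ∷ u)
                                  (s≤s (s≤s z≤n)) (edge-sym aq)

  path-unique : ∀ {a b xs ys} → Chain Edge a b xs → Unique (a ∷ xs) →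
                Chain Edge a b ys → Unique (a ∷ ys) → xs ≡ ys
  path-unique [] _ [] _ = refl
  path-unique [] _ (_ ∷ d) (a∉ ∷ _) = ⊥-elim (All¬⇒¬Any a∉ (end∈ d))
  path-unique (_ ∷ c) (a∉ ∷ _) [] _ = ⊥-elim (All¬⇒¬Any a∉ (end∈ c))
  path-unique {a} {xs = p ∷ _} {q ∷ _} (ap ∷ c) (a∉c ∷ u) (aq ∷ d) (a∉d ∷ v) with p ≟ᶠ q
  ... | yes refl = cong (p ∷_) (path-unique c u d v)
  ... | no p≢q = ⊥-elim (no-bypass ap aq p≢q (All.head a∉c) (within a∉c c ++ᶜ proj₂ d⁻¹))
    where d⁻¹ = reverseᶜ (within-sym {P = a ≢_} edge-sym) (within a∉d d)

  no-directed-cycle : ∀ {x y xs} → Arc T x y → Chain (Arc T) y x xs → ⊥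
  no-directed-cycle {x} xy c with erase-loops _≟ᶠ_ c
  ... | [] , [] , _ with trans (sym xy) (proj₁ oriented x)
  ...   | ()
  no-directed-cycle {x} {y} xy c | _ ∷ [] , yx ∷ [] , _ with trans (sym yx) (proj₂ oriented x y xy)
  ...   | ()
  no-directed-cycle xy c | _ ∷ _ ∷ _ , c′ , u = no-cycle (mapᶜ arc⇒edge c′) u (s≤s (s≤s z≤n)) (arc⇒edge xy)

  directed-unique : ∀ {x y xs} → Chain (Arc T) x y xs → Unique (x ∷ xs)
  directed-unique [] = [] ∷ []
  directed-unique (xy ∷ c) =
    ¬Any⇒All¬ _ (λ x∈ → no-directed-cycle xy (proj₂ (prefix c x∈))) ∷ directed-unique c

  chain⇒dipath : ∀ {x y xs} → Chain (Arc T) x y xs → Path T x y (length xs)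
  chain⇒dipath c = chain⇒path T c (directed-unique c)

  dipath-unique : ∀ {x y xs ys} → Chain (Arc T) x y xs → Chain (Arc T) x y ys → xs ≡ ys
  dipath-unique c d = path-unique (mapᶜ arc⇒edge c) (directed-unique c) (mapᶜ arc⇒edge d) (directed-unique d)

  directedPaths : DirectedPaths (Fin k)
  directedPaths = record
    { _⟶[_]_ = λ x L y → Path T x y L
    ; ⟶-refl = chain⇒dipath []
    ; ⟶-trans = concat
    ; ⟶-unique = unique
    ; ⟶-zero = λ p → trans (sym (Path.start p)) (Path.end p)
    ; ⟶-comparable = comparable
    }
    where
    concat : ∀ {x y z p q} → Path T x y p → Path T y z q → Path T x z (p + q)
    concat P Q with path⇒chain T P | path⇒chain T Q
    ... | xs , c , refl | _ , d , refl = subst (Path T _ _) (length-++ xs) (chain⇒dipath (c ++ᶜ d))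

    unique : ∀ {x y p q} → Path T x y p → Path T x y q → p ≡ q
    unique P Q with path⇒chain T P | path⇒chain T Q
    ... | _ , c , refl | _ , d , refl = cong length (dipath-unique c d)

    comparable : ∀ {a b y z p q r s} → Path T a y p → Path T y b q → Path T a z r → Path T z b s →
                 (∃ λ L → Path T y z L) ⊎ (∃ λ L → Path T z y L)
    comparable {a} {z = z} P Q R S with path⇒chain T P | path⇒chain T Q | path⇒chain T R | path⇒chain T S
    ... | xs , ay , _ | _ , yb , _ | _ , az , _ | _ , zb , _ with ∈-++⁻ (a ∷ xs) z∈
      where
      z∈ : z ∈ a ∷ xs ++ _
      z∈ = subst (z ∈_) (cong (a ∷_) (dipath-unique (az ++ᶜ zb) (ay ++ᶜ yb))) (∈-++⁺ˡ (end∈ az))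
    ...   | inj₁ z∈ay = let _ , zy , u = suffix ay (directed-unique ay) z∈ay in inj₂ (_ , chain⇒path T zy u)
    ...   | inj₂ z∈yb = inj₁ (_ , chain⇒dipath (proj₂ (prefix yb (there z∈yb))))

-- Congruence of signed heights

y≡-x+[x+y] : ∀ (x y : ℤ) → y ≡ - x ℤ.+ (x ℤ.+ y)
y≡-x+[x+y] = solve-∀

-y≡-[x+y]+x : ∀ (x y : ℤ) → - y ≡ - (x ℤ.+ y) ℤ.+ x
-y≡-[x+y]+x = solve-∀

x-[x+y]≡-y : ∀ (x y : ℤ) → x ℤ.- (x ℤ.+ y) ≡ - y
x-[x+y]≡-y = solve-∀

-[x-y]≡y-x : ∀ (x y : ℤ) → - (x ℤ.- y) ≡ y ℤ.- x
-[x-y]≡y-x = solve-∀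

[x-y]+[y-z]≡x-z : ∀ (x y z : ℤ) → (x ℤ.- y) ℤ.+ (y ℤ.- z) ≡ x ℤ.- z
[x-y]+[y-z]≡x-z = solve-∀

infix 4 _≡_mod_
_≡_mod_ : ℤ → ℤ → ℕ → Set
x ≡ y mod m = + m ∣ℤ x ℤ.- y

module _ {m : ℕ} where

  ≡mod-sym : ∀ {x y} → x ≡ y mod m → y ≡ x mod m
  ≡mod-sym {x} {y} x≡y = subst (+ m ∣ℤ_) (-[x-y]≡y-x x y) (∣m⇒∣-m x≡y)

  ≡mod-trans : ∀ {x y z} → x ≡ y mod m → y ≡ z mod m → x ≡ z mod m
  ≡mod-trans {x} {y} {z} x≡y y≡z = subst (+ m ∣ℤ_) ([x-y]+[y-z]≡x-z x y z) (∣m∣n⇒∣m+n x≡y y≡z)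

  ≡mod-shift : ∀ x L → x ≡ x ℤ.+ + L mod m ⇔ m ∣ L
  ≡mod-shift x L = mk⇔
    (λ m∣ → subst (m ∣_) (∣-i∣≡∣i∣ (+ L)) (∣⇒∣ᵤ (subst (+ m ∣ℤ_) (x-[x+y]≡-y x (+ L)) m∣)))
    (λ m∣L → subst (+ m ∣ℤ_) (sym (x-[x+y]≡-y x (+ L))) (∣m⇒∣-m (∣ᵤ⇒∣ m∣L)))

module Heights {V : Set} (P : DirectedPaths V) (c : V) where
  open DirectedPaths P

  height : ∀ {ℓ x} → c ⟷[ ℓ ] x → ℤ
  height {ℓ} (inj₁ _) = + ℓ
  height {ℓ} (inj₂ _) = - + ℓ

  height-step : ∀ {ℓx ℓy x y L} (cx : c ⟷[ ℓx ] x) (cy : c ⟷[ ℓy ] y) → x ⟶[ L ] y →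
                height cy ≡ height cx ℤ.+ + L
  height-step {ℓx} {L = L} (inj₁ cx) (inj₁ cy) xy with ⟶-unique cy (⟶-trans cx xy)
  ... | refl = pos-+ ℓx L
  height-step {ℓx} {ℓy} {L = L} (inj₂ xc) (inj₁ cy) xy with ⟶-unique (⟶-trans xc cy) xy
  ... | refl = trans (y≡-x+[x+y] (+ ℓx) (+ ℓy)) (cong (λ t → - + ℓx ℤ.+ t) (sym (pos-+ ℓx ℓy)))
  height-step {ℓy = ℓy} {L = L} (inj₂ xc) (inj₂ yc) xy with ⟶-unique xc (⟶-trans xy yc)
  ... | refl = trans (-y≡-[x+y]+x (+ L) (+ ℓy)) (cong (λ t → - t ℤ.+ + L) (sym (pos-+ L ℓy)))
  -- c → x → y → c is a closed directed path, so all three lengths vanish.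
  height-step {ℓx} {ℓy} {L = L} (inj₁ cx) (inj₂ yc) xy with ⟶-unique (⟶-trans (⟶-trans cx xy) yc) ⟶-refl
  ... | loop with m+n≡0⇒n≡0 (ℓx + L) loop
  ...   | refl = sym (trans (sym (pos-+ ℓx L)) (cong +_ (m+n≡0⇒m≡0 (ℓx + L) loop)))

-- Seven path vertices

apart : ℕ → ℕ → Bool
apart x y = (2 + x ≤ᵇ y) ∨ (2 + y ≤ᵇ x)

-- A record, not a synonym, so that Far i j determines i and j; for concrete i and j its proof is
-- inferred, the field reducing to ⊤.
record Far {n} (i j : Fin n) : Set where
  constructor far
  field apart-toℕ : T (apart (toℕ i) (toℕ j))

far-sym : ∀ {n} {i j : Fin n} → Far i j → Far j i
far-sym {i = i} {j} (far ij) = far (subst T (∨-comm (2 + toℕ i ≤ᵇ toℕ j) (2 + toℕ j ≤ᵇ toℕ i)) ij)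

apart⇒non-adjacent : ∀ x y → T (apart x y) → x ≢ y × suc x ≢ y
apart⇒non-adjacent zero (suc (suc y)) _ = (λ ()) , (λ ())
apart⇒non-adjacent (suc (suc x)) zero _ = (λ ()) , (λ ())
apart⇒non-adjacent (suc x) (suc y) xy with apart⇒non-adjacent x y xy
... | x≢y , sx≢y = (λ eq → x≢y (suc-injective eq)) , (λ eq → sx≢y (suc-injective eq))

far⇒non-adjacent : ∀ {n} {i j : Fin n} → Far i j → toℕ i ≢ toℕ j × suc (toℕ i) ≢ toℕ j
far⇒non-adjacent (far ij) = apart⇒non-adjacent _ _ ij

far-consecutive : ∀ z → ∃ λ (a : Fin 6) → Far z (inject₁ a) × Far z (suc a)
far-consecutive 0F = 5F , _
far-consecutive 1F = 5F , _
far-consecutive 2F = 4F , _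
far-consecutive 3F = 0F , _
far-consecutive 4F = 0F , _
far-consecutive 5F = 0F , _
far-consecutive 6F = 0F , _

module Colouring {E : Rel (Fin 7) 0ℓ} (E-sym : Symmetric E) (E-trans : Transitive E) (colour : Fin 7 → Bool)
  (consecutive-apart : ∀ a → ¬ E (inject₁ a) (suc a))
  (far-split : ∀ {i j} → Far i j → colour i ≢ colour j → E i j) where

  -- w differs in colour from i or from j, and is then related to it by far-split.
  related-to-split-pair : ∀ {i j w} → colour i ≢ colour j → E i j → Far w i → Far w j → E w i
  related-to-split-pair {i} {j} {w} i≢j Eij wi wj with colour w Bool.≟ colour i
  ... | yes w≡i = E-trans (far-split wj (λ w≡j → i≢j (trans (sym w≡i) w≡j))) (E-sym Eij)
  ... | no w≢i = far-split wi w≢i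

  same-colour : ∀ {i j} a {_ : Far i j} {_ : Far (inject₁ a) i} {_ : Far (inject₁ a) j}
                {_ : Far (suc a) i} {_ : Far (suc a) j} → colour i ≡ colour j
  same-colour {i} {j} a {ij} {ai} {aj} {a′i} {a′j} with colour i Bool.≟ colour j
  ... | yes i≡j = i≡j
  ... | no i≢j = ⊥-elim (consecutive-apart a (E-trans (related-to-split-pair i≢j Eij ai aj)
                                                      (E-sym (related-to-split-pair i≢j Eij a′i a′j))))
    where Eij = far-split ij i≢j

  colour-constant : ∀ i → colour i ≡ colour 0F
  colour-constant 0F = refl
  colour-constant 1F = trans (same-colour {1F} {3F} 5F) (sym (same-colour {0F} {3F} 5F))
  colour-constant 2F = sym (same-colour {0F} {2F} 4F)
  colour-constant 3F = sym (same-colour {0F} {3F} 5F)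
  colour-constant 4F = trans (same-colour {4F} {6F} 0F) (sym (same-colour {0F} {6F} 2F))
  colour-constant 5F = sym (same-colour {0F} {5F} 2F)
  colour-constant 6F = sym (same-colour {0F} {6F} 2F)

minimum-at : ∀ {n} (f : Fin (suc n) → ℕ) → ∃ λ z → ∀ j → f z ≤ f j
minimum-at f = argmin f 0F (allFin _) , λ j → All.lookup (f[argmin]≤f[xs] {f = f} 0F (allFin _)) (∈-allFin j)

propagate : ∀ {n} (P : Fin (suc n) → Set) → (∀ a → P (inject₁ a) → P (suc a)) →
            (∀ a → P (suc a) → P (inject₁ a)) → ∀ {z} → P z → ∀ j → P j
propagate P up down {z} Pz = <-weakInduction P P0 up
  where P0 = <-weakInduction (λ j → P j → P 0F) (λ p → p) (λ j back Psj → back (down j Psj)) z Pz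

-- Fans in oriented forests

-- What an m-willow representation of F_n says about its centre and first seven path vertices.
record Fan₇ {V : Set} (P : DirectedPaths V) (m : ℕ) : Set where
  open DirectedPaths P
  field
    centre : V
    spine : Fin 7 → V
    centre-linked : ∀ i → ∃ λ ℓ → centre ⟷[ ℓ ] spine i
    spine-linked : ∀ a → ∃ λ L → spine (inject₁ a) ⟷[ L ] spine (suc a) × ¬ m ∣ L
    far-divisible : ∀ {i j L} → Far i j → spine i ⟶[ L ] spine j → m ∣ L

reverse-fan : ∀ {V} {P : DirectedPaths V} {m} → Fan₇ P m → Fan₇ (opposite P) m
reverse-fan F = record
  { centre = centre
  ; spine = spine
  ; centre-linked = λ i → Product.map₂ Sum.swap (centre-linked i)
  ; spine-linked = λ a → Product.map₂ (Product.map₁ Sum.swap) (spine-linked a)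
  ; far-divisible = λ ij ji → far-divisible (far-sym ij) ji
  }
  where open Fan₇ F

module FanFacts {V} {P : DirectedPaths V} {m} (F : Fan₇ P m) where
  open DirectedPaths P
  open Fan₇ F
  open Heights P centre

  h : Fin 7 → ℤ
  h i = height (proj₂ (centre-linked i))

  _≈_ : Rel (Fin 7) 0ℓ
  i ≈ j = h i ≡ h j mod m

  ≈-sym : Symmetric _≈_
  ≈-sym {i} {j} = ≡mod-sym {x = h i} {h j}

  ≈-trans : Transitive _≈_
  ≈-trans {i} {j} {k} = ≡mod-trans {x = h i} {h j} {h k}

  ≈-path : ∀ {i j L} → spine i ⟶[ L ] spine j → i ≈ j ⇔ m ∣ L
  ≈-path {i} {j} {L} p =
    subst (λ t → h i ≡ t mod m ⇔ m ∣ L) (sym (height-step (proj₂ (centre-linked i)) (proj₂ (centre-linked j)) p))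
          (≡mod-shift (h i) L)

  consecutive-apart : ∀ a → ¬ inject₁ a ≈ suc a
  consecutive-apart a with spine-linked a
  ... | _ , inj₁ p , m∤L = λ a≈a′ → m∤L (Equivalence.to (≈-path p) a≈a′)
  ... | _ , inj₂ p , m∤L = λ a≈a′ → m∤L (Equivalence.to (≈-path p) (≈-sym a≈a′))

  far-congruent : ∀ {i j L} → Far i j → spine i ⟶[ L ] spine j → i ≈ j
  far-congruent ij p = Equivalence.from (≈-path p) (far-divisible ij p)

  outward : ∀ {ℓ x} → centre ⟷[ ℓ ] x → Bool
  outward (inj₁ _) = true
  outward (inj₂ _) = false

  colour : Fin 7 → Bool
  colour i = outward (proj₂ (centre-linked i))

  through-centre : ∀ {ℓx ℓy x y} (cx : centre ⟷[ ℓx ] x) (cy : centre ⟷[ ℓy ] y) → outward cx ≢ outward cy →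
                   (∃ λ L → x ⟶[ L ] y) ⊎ (∃ λ L → y ⟶[ L ] x)
  through-centre (inj₁ _) (inj₁ _) ne = ⊥-elim (ne refl)
  through-centre (inj₁ cx) (inj₂ yc) _ = inj₂ (_ , ⟶-trans yc cx)
  through-centre (inj₂ xc) (inj₁ cy) _ = inj₁ (_ , ⟶-trans xc cy)
  through-centre (inj₂ _) (inj₂ _) ne = ⊥-elim (ne refl)

  far-split : ∀ {i j} → Far i j → colour i ≢ colour j → i ≈ j
  far-split {i} {j} ij ne with through-centre (proj₂ (centre-linked i)) (proj₂ (centre-linked j)) ne
  ... | inj₁ (_ , p) = far-congruent ij p
  ... | inj₂ (_ , p) = ≈-sym (far-congruent (far-sym ij) p)

  open Colouring ≈-sym ≈-trans colour consecutive-apart far-split public using (colour-constant)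

  outward-path : ∀ {ℓ x} (cx : centre ⟷[ ℓ ] x) → outward cx ≡ true → centre ⟶[ ℓ ] x
  outward-path (inj₁ cx) _ = cx

  inward-path : ∀ {ℓ x} (cx : centre ⟷[ ℓ ] x) → outward cx ≡ false → x ⟶[ ℓ ] centre
  inward-path (inj₂ xc) _ = xc

  -- If y → x, then y and the closest z are comparable, both lying on the path from the centre to x;
  -- and y → z is impossible unless y = z.
  closest-reaches-all : (out : ∀ i → ∃ λ ℓ → centre ⟶[ ℓ ] spine i) →
                        ∀ {z} → (∀ j → proj₁ (out z) ≤ proj₁ (out j)) → ∀ j → ∃ λ L → spine z ⟶[ L ] spine j
  closest-reaches-all out {z} z-closest =
    propagate Reached (λ a r → extend r (linked a)) (λ a r → extend r (Sum.swap (linked a))) (0 , ⟶-refl)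
    where
    Reached : Fin 7 → Set
    Reached j = ∃ λ L → spine z ⟶[ L ] spine j

    linked : ∀ a → spine (inject₁ a) ⟷[ _ ] spine (suc a)
    linked a = proj₁ (proj₂ (spine-linked a))

    reached-back : ∀ {y L} → spine y ⟶[ L ] spine z → Reached y
    reached-back {L = zero} yz = 0 , subst (spine z ⟶[ 0 ]_) (sym (⟶-zero yz)) ⟶-refl
    reached-back {y} {suc L} yz = ⊥-elim (m+1+n≰m (proj₁ (out y))
      (subst (_≤ proj₁ (out y)) (⟶-unique (proj₂ (out z)) (⟶-trans (proj₂ (out y)) yz)) (z-closest y)))

    extend : ∀ {x y L} → Reached x → spine x ⟷[ L ] spine y → Reached y
    extend (_ , zx) (inj₁ xy) = _ , ⟶-trans zx xy
    extend (_ , zx) (inj₂ yx) with ⟶-comparable (proj₂ (out z)) zx (proj₂ (out _)) yx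
    ... | inj₁ zy = zy
    ... | inj₂ (_ , yz) = reached-back yz

  centre-not-source : (∀ i → ∃ λ ℓ → centre ⟶[ ℓ ] spine i) → ⊥
  centre-not-source out = from-closest (minimum-at (λ i → proj₁ (out i)))
    where
    -- Pattern matching on minimum-at in a with would make Agda normalise argmin, which is very slow.
    from-closest : (∃ λ z → ∀ j → proj₁ (out z) ≤ proj₁ (out j)) → ⊥
    from-closest (z , z-closest) with far-consecutive z
    ... | a , za , za′ = consecutive-apart a (≈-trans (≈-sym (far-congruent za (reach (inject₁ a))))
                                                     (far-congruent za′ (reach (suc a))))
      where reach = λ j → proj₂ (closest-reaches-all out z-closest j)

no-fan : ∀ {V} {P : DirectedPaths V} {m} → ¬ Fan₇ P m
no-fan F = one-sided (colour 0F) colour-constant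
  where
  open FanFacts F
  one-sided : ∀ β → (∀ i → colour i ≡ β) → ⊥
  one-sided true out = centre-not-source (λ i → _ , outward-path _ (out i))
  one-sided false inw = FanFacts.centre-not-source (reverse-fan F) (λ i → _ , inward-path _ (inw i))

module WillowFan {n m k : ℕ} {T : Digraph k} (7≤n : 7 ≤ n) (oriented : Oriented T) (acyclic : ¬ HasCycle T)
  (f : Fin (suc n) → Fin k)
  (adj⇔path : ∀ u v → u ≢ v → FanAdj n u v ⇔ (GoodDirPath m T (f u) (f v) ⊎ GoodDirPath m T (f v) (f u))) where

  open OrientedForest T oriented acyclic using (directedPaths)
  open DirectedPaths directedPaths using (_⟷[_]_)

  spine-vertex : Fin 7 → Fin (suc n)
  spine-vertex i = suc (inject≤ i 7≤n)

  toℕ-spine-vertex : ∀ i → toℕ (spine-vertex i) ≡ suc (toℕ i)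
  toℕ-spine-vertex i = cong suc (toℕ-inject≤ i 7≤n)

  spine-successor : ∀ i j → suc (toℕ (spine-vertex i)) ≡ toℕ (spine-vertex j) → suc (toℕ i) ≡ toℕ j
  spine-successor i j e =
    suc-injective (trans (cong suc (sym (toℕ-spine-vertex i))) (trans e (toℕ-spine-vertex j)))

  far-not-adjacent : ∀ {i j} → Far i j → ¬ FanAdj n (spine-vertex i) (spine-vertex j)
  far-not-adjacent {i} {j} ij (inj₂ (inj₂ (inj₁ (_ , e)))) = proj₂ (far⇒non-adjacent ij) (spine-successor i j e)
  far-not-adjacent {i} {j} ij (inj₂ (inj₂ (inj₂ (_ , e)))) = proj₂ (far⇒non-adjacent (far-sym ij)) (spine-successor j i e)

  far-distinct : ∀ {i j} → Far i j → spine-vertex i ≢ spine-vertex j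
  far-distinct {i} {j} ij eq = proj₁ (far⇒non-adjacent ij)
    (suc-injective (trans (sym (toℕ-spine-vertex i)) (trans (cong toℕ eq) (toℕ-spine-vertex j))))

  good⇒linked : ∀ {x y} → GoodDirPath m T x y ⊎ GoodDirPath m T y x → ∃ λ L → x ⟷[ L ] y × ¬ m ∣ L
  good⇒linked (inj₁ (L , p , m∤L)) = L , inj₁ p , m∤L
  good⇒linked (inj₂ (L , p , m∤L)) = L , inj₂ p , m∤L

  fan : Fan₇ directedPaths m
  fan = record
    { centre = f 0F
    ; spine = λ i → f (spine-vertex i)
    ; centre-linked = λ i → Product.map₂ proj₁
        (good⇒linked (Equivalence.to (adj⇔path 0F (spine-vertex i) (λ ())) (inj₁ (refl , λ ()))))
    ; spine-linked = λ a →
        good⇒linked (Equivalence.to (adj⇔path _ _ (distinct a)) (inj₂ (inj₂ (inj₁ ((λ ()) , successor a)))))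
    ; far-divisible = far-divisible
    }
    where
    successor : ∀ a → suc (toℕ (spine-vertex (inject₁ a))) ≡ toℕ (spine-vertex (suc a))
    successor a = trans (cong suc (trans (toℕ-spine-vertex (inject₁ a)) (cong suc (toℕ-inject₁ a))))
                        (sym (toℕ-spine-vertex (suc a)))
    distinct : ∀ a → spine-vertex (inject₁ a) ≢ spine-vertex (suc a)
    distinct a eq = 1+n≢n (trans (successor a) (sym (cong toℕ eq)))
    far-divisible : ∀ {i j L} → Far i j → Path T (f (spine-vertex i)) (f (spine-vertex j)) L → m ∣ L
    far-divisible {i} {j} {L} ij p with m ∣? L
    ... | yes m∣L = m∣L
    ... | no m∤L =
      ⊥-elim (far-not-adjacent ij (Equivalence.from (adj⇔path _ _ (far-distinct ij)) (inj₁ (L , p , m∤L))))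

proposition9p8 : ∀ (n : ℕ) → 7 ≤ n → ¬ IsWillow (suc n) (FanAdj n)
proposition9p8 n 7≤n (m , _ , _ , T , (oriented , _ , acyclic) , f , _ , adj⇔path) =
  no-fan (WillowFan.fan 7≤n oriented acyclic f adj⇔path)
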